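{- Let $G$ be a directed graph and $k\ge 0$ an integer. The collection of all directed forests in $G$ with exactly $k$ arcs (viewed as arc sets) satisfies the weak exchange property: for any two distinct directed forests $F\neq F'$ in $G$ with $|F|=|F'|$, there exist arcs $e\in F\setminus F'$ and $e'\in F'\setminus F$ such that $(F\setminus\{e\})\cup\{e'\}$ is a directed forest in $G$.
   Context: A directed tree is a directed graph whose underlying undirected graph is a tree and in which every vertex except one vertex (the root) has in-degree exactly $1$. A directed forest is a directed graph that is a disjoint union of directed trees; a directed forest in $G$ is a subgraph of $G$ (identified with its arc set) that is a directed forest. $|F|$ denotes the number of arcs of $F$. -}

module Defs where

open import Data.Nat using (ℕ; suc)
open import Data.Fin using (Fin; zero; suc; fromℕ; inject₁)
open import Data.Fin.Subset using (Subset; _∈_)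
open import Data.Product using (_×_)
open import Data.Sum using (_⊎_)
open import Relation.Binary.PropositionalEquality using (_≡_)
import Data.Empty

record Digraph : Set where
  field
    nV   : ℕ
    nA   : ℕ
    tail : Fin nA → Fin nV
    head : Fin nA → Fin nV

open Digraph public

ArcSet : Digraph → Set
ArcSet G = Subset (nA G)

Joins : (G : Digraph) → Fin (nA G) → Fin (nV G) → Fin (nV G) → Set
Joins G a u w = (tail G a ≡ u × head G a ≡ w) ⊎ (tail G a ≡ w × head G a ≡ u)

-- A cycle in the underlying undirected multigraph of the arc set F:
-- a closed trail v0 -a0- v1 -a1- ... -ak- v(k+1) = v0 using
-- pairwise distinct arcs of F (k+1 ≥ 1 arcs; loops and pairs of
-- parallel arcs count as cycles).
record UCycle (G : Digraph) (F : ArcSet G) : Set where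
  field
    len      : ℕ
    arc      : Fin (suc len) → Fin (nA G)
    vtx      : Fin (suc (suc len)) → Fin (nV G)
    arc-inj  : ∀ i j → arc i ≡ arc j → i ≡ j
    arc-in   : ∀ i → arc i ∈ F
    joins    : ∀ i → Joins G (arc i) (vtx (inject₁ i)) (vtx (suc i))
    closed   : vtx zero ≡ vtx (fromℕ (suc len))

-- F is a directed forest in G: a disjoint union of directed trees, i.e.
-- its underlying undirected graph is a forest (no cycle) and every
-- vertex has in-degree at most 1 (roots in-degree 0, others exactly 1).
record IsDirectedForest (G : Digraph) (F : ArcSet G) : Set where
  field
    acyclic   : UCycle G F → Data.Empty.⊥
    indeg≤1   : ∀ a b → a ∈ F → b ∈ F → head G a ≡ head G b → a ≡ b

{-# OPTIONS --safe #-}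
-- With in-degree at most one, an undirected cycle is directed all the way round, so a set of
-- arcs with distinct heads is a directed forest exactly when every vertex climbs (against the
-- arcs) to a root. Hence (F - e) ∪ ⁅ e′ ⁆ is a directed forest as soon as hd e′ is a root of
-- F - e that tl e′ cannot climb to in F - e.
-- If some arc e′ ∈ F′ enters a root of F, remove from F the topmost arc outside F′ on the climb
-- from tl e′ to its root; if that climb lies in F′, any arc of F ∖ F′ will do, for otherwise the
-- climb together with e′ would be a directed cycle in F′. If every head of F′ is a head of F,
-- then |F| = |F′| makes the heads, hence the roots, of F and F′ coincide; climbing in F′ from
-- the tail of an arc of F′ ∖ F, the topmost arc e′ outside F replaces the arc of F entering hd e′.

module Submission where

open import Defs
open import Data.Nat using (ℕ; zero; suc; _≤_; _<_; _≤′_; z≤n; s≤s; ≤′-refl; ≤′-step)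
open import Data.Nat.Properties using (≤-refl; ≤-trans; <⇒≤; <⇒≢; n≤0⇒n≡0; 1+n≢n; ≤⇒≤′; n<1+n; anyUpTo?)
open import Data.Fin using (Fin; zero; suc; toℕ; fromℕ; inject₁)
open import Data.Fin.Properties using (toℕ-injective; toℕ-inject₁; toℕ-fromℕ; toℕ≤pred[n]; toℕ<n; suc-injective; any?; pigeonhole; _≟_)
open import Data.Fin.Subset using (Subset; inside; outside; _∈_; _∉_; _⊆_; _∪_; _∩_; _-_; ⁅_⁆; ∣_∣; ⊥)
open import Data.Fin.Subset.Properties
  using (_∈?_; ⊆-antisym; p⊂q⇒∣p∣<∣q∣; x∈⁅x⁆; x∈⁅y⁆⇒x≡y; ∣⊥∣≡0; ∉⊥; ∪-identityˡ; x∈p∪q⁺; x∈p∪q⁻; p⊆p∪q; x∈p∩q⁺; x∈p∩q⁻; p∩q⊆p; p∩q⊆q; p─q⊆p)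
open import Data.Bool using (Bool)
open import Data.Vec using (_∷_; []; here; there)
open import Data.Product using (_×_; _,_; proj₁; proj₂; ∃; ∃₂)
open import Data.Sum using (_⊎_; inj₁; inj₂; map₂)
open import Data.Empty using (⊥-elim) renaming (⊥ to ⊥₀)
open import Function using (_∘_; id; flip)
open import Relation.Binary using (Rel)
open import Relation.Binary.Construct.Closure.ReflexiveTransitive using (Star; ε; _◅_; _◅◅_; gmap; reverse)
open import Relation.Binary.PropositionalEquality using (_≡_; _≢_; refl; sym; trans; cong; subst)
open import Relation.Nullary using (¬_; Dec; yes; no)
open import Relation.Nullary.Decidable using (_×-dec_; ¬?; map′; decidable-stable)

private variable
  m n : ℕ

x∉p-x : {p : Subset n} {x : Fin n} → x ∉ p - x
x∉p-x {p = _ ∷ _} {zero} ()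
x∉p-x {p = _ ∷ _} {suc x} (there x∈) = x∉p-x x∈

x∈p∪⁅y⁆⁻ : {p : Subset n} {x y : Fin n} → x ∈ p ∪ ⁅ y ⁆ → x ∈ p ⊎ x ≡ y
x∈p∪⁅y⁆⁻ {p = p} {y = y} = map₂ (x∈⁅y⁆⇒x≡y y) ∘ x∈p∪q⁻ p ⁅ y ⁆

⊆-or-witness : (p q : Subset n) → p ⊆ q ⊎ ∃ λ x → x ∈ p × x ∉ q
⊆-or-witness p q with any? (λ x → x ∈? p ×-dec ¬? (x ∈? q))
... | yes witness = inj₂ witness
... | no ¬witness = inj₁ λ {x} x∈p → decidable-stable (x ∈? q) (λ x∉q → ¬witness (x , x∈p , x∉q))

⊆∧∣≡∣⇒⊇ : {p q : Subset n} → p ⊆ q → ∣ p ∣ ≡ ∣ q ∣ → q ⊆ p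
⊆∧∣≡∣⇒⊇ {p = p} p⊆q ∣p∣≡∣q∣ {x} x∈q with x ∈? p
... | yes x∈p = x∈p
... | no x∉p = ⊥-elim (<⇒≢ (p⊂q⇒∣p∣<∣q∣ (p⊆q , x , x∈q , x∉p)) ∣p∣≡∣q∣)

∣p∣≡∣q∣∧p≢q⇒∃x∈p∉q : {p q : Subset n} → ∣ p ∣ ≡ ∣ q ∣ → p ≢ q → ∃ λ x → x ∈ p × x ∉ q
∣p∣≡∣q∣∧p≢q⇒∃x∈p∉q {p = p} {q} ∣p∣≡∣q∣ p≢q with ⊆-or-witness p q
... | inj₂ witness = witness
... | inj₁ p⊆q = ⊥-elim (p≢q (⊆-antisym p⊆q (⊆∧∣≡∣⇒⊇ p⊆q ∣p∣≡∣q∣)))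

∣⁅x⁆∪p∣≡1+∣p∣ : {p : Subset n} {x : Fin n} → x ∉ p → ∣ ⁅ x ⁆ ∪ p ∣ ≡ suc ∣ p ∣
∣⁅x⁆∪p∣≡1+∣p∣ {p = outside ∷ p} {zero}  _   = cong (suc ∘ ∣_∣) (∪-identityˡ p)
∣⁅x⁆∪p∣≡1+∣p∣ {p = inside  ∷ p} {zero}  x∉p = ⊥-elim (x∉p here)
∣⁅x⁆∪p∣≡1+∣p∣ {p = outside ∷ p} {suc x} x∉p = ∣⁅x⁆∪p∣≡1+∣p∣ (x∉p ∘ there)
∣⁅x⁆∪p∣≡1+∣p∣ {p = inside  ∷ p} {suc x} x∉p = cong suc (∣⁅x⁆∪p∣≡1+∣p∣ (x∉p ∘ there))

InjectiveOn : {A : Set} → (Fin n → A) → Subset n → Set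
InjectiveOn f p = ∀ a b → a ∈ p → b ∈ p → f a ≡ f b → a ≡ b

InjectiveOn-∷ : {A : Set} {f : Fin (suc n) → A} {s : Bool} {p : Subset n} → InjectiveOn f (s ∷ p) → InjectiveOn (f ∘ suc) p
InjectiveOn-∷ inj a b a∈ b∈ = suc-injective ∘ inj (suc a) (suc b) (there a∈) (there b∈)

image : (Fin m → Fin n) → Subset m → Subset n
image f []            = ⊥
image f (outside ∷ p) = image (f ∘ suc) p
image f (inside  ∷ p) = ⁅ f zero ⁆ ∪ image (f ∘ suc) p

∈image⁺ : {f : Fin m → Fin n} {p : Subset m} {x : Fin m} → x ∈ p → f x ∈ image f p
∈image⁺ {p = inside  ∷ p} here        = x∈p∪q⁺ (inj₁ (x∈⁅x⁆ _))
∈image⁺ {p = outside ∷ p} (there x∈p) = ∈image⁺ x∈p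
∈image⁺ {p = inside  ∷ p} (there x∈p) = x∈p∪q⁺ (inj₂ (∈image⁺ x∈p))

∈image⁻ : {f : Fin m → Fin n} {p : Subset m} {y : Fin n} → y ∈ image f p → ∃ λ x → x ∈ p × f x ≡ y
∈image⁻ {p = []} y∈ = ⊥-elim (∉⊥ y∈)
∈image⁻ {p = outside ∷ p} y∈ with ∈image⁻ y∈
... | x , x∈p , fx≡y = suc x , there x∈p , fx≡y
∈image⁻ {f = f} {p = inside ∷ p} y∈ with x∈p∪q⁻ ⁅ f zero ⁆ (image (f ∘ suc) p) y∈
... | inj₁ y∈⁅f0⁆ = zero , here , sym (x∈⁅y⁆⇒x≡y _ y∈⁅f0⁆)
... | inj₂ y∈img with ∈image⁻ y∈img
...   | x , x∈p , fx≡y = suc x , there x∈p , fx≡y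

∣image∣≡∣p∣ : {f : Fin m → Fin n} {p : Subset m} → InjectiveOn f p → ∣ image f p ∣ ≡ ∣ p ∣
∣image∣≡∣p∣ {n = n} {p = []} _ = ∣⊥∣≡0 n
∣image∣≡∣p∣ {p = outside ∷ p} inj = ∣image∣≡∣p∣ (InjectiveOn-∷ inj)
∣image∣≡∣p∣ {f = f} {p = inside ∷ p} inj = trans (∣⁅x⁆∪p∣≡1+∣p∣ f0∉) (cong suc (∣image∣≡∣p∣ (InjectiveOn-∷ inj)))
  where
  f0∉ : f zero ∉ image (f ∘ suc) p
  f0∉ f0∈ with ∈image⁻ f0∈
  ... | x , x∈p , fx≡f0 with inj (suc x) zero (there x∈p) here fx≡f0
  ... | ()

star-along : ∀ {a ℓ} {A : Set a} {R : Rel A ℓ} (w : ℕ → A) n →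
             (∀ {k} → k < n → R (w k) (w (suc k))) → Star R (w 0) (w n)
star-along w zero    _    = ε
star-along w (suc n) step = step (s≤s z≤n) ◅ star-along (w ∘ suc) n (λ k<n → step (s≤s k<n))

cons : {A : Set} → A → (ℕ → A) → ℕ → A
cons x f zero    = x
cons x f (suc k) = f k

InjectiveBelow : {A : Set} → (ℕ → A) → ℕ → Set
InjectiveBelow f n = ∀ {i j} → i < n → j < n → f i ≡ f j → i ≡ j

cons-injective : {A : Set} {f : ℕ → A} {x : A} →
                 InjectiveBelow f n → (∀ {j} → j < n → f j ≢ x) → InjectiveBelow (cons x f) (suc n)
cons-injective inj fresh {zero}  {zero}  _         _         _     = refl
cons-injective inj fresh {zero}  {suc j} _         (s≤s j<n) x≡fj = ⊥-elim (fresh j<n (sym x≡fj))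
cons-injective inj fresh {suc i} {zero}  (s≤s i<n) _         fi≡x = ⊥-elim (fresh i<n fi≡x)
cons-injective inj fresh {suc i} {suc j} (s≤s i<n) (s≤s j<n) fi≡fj = cong suc (inj i<n j<n fi≡fj)

-- Saturates at n; only used on k ≤ n.
clamp : ∀ n → ℕ → Fin (suc n)
clamp n       zero    = zero
clamp zero    (suc k) = zero
clamp (suc n) (suc k) = suc (clamp n k)

toℕ-clamp : ∀ {n k} → k ≤ n → toℕ (clamp n k) ≡ k
toℕ-clamp {n}     {zero}  _         = refl
toℕ-clamp {suc n} {suc k} (s≤s k≤n) = cong suc (toℕ-clamp k≤n)

inject₁-clamp : ∀ {n k} → k ≤ n → inject₁ (clamp n k) ≡ clamp (suc n) k
inject₁-clamp {n}     {zero}  _         = refl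
inject₁-clamp {suc n} {suc k} (s≤s k≤n) = cong suc (inject₁-clamp k≤n)

clamp-fromℕ : ∀ n → clamp n n ≡ fromℕ n
clamp-fromℕ zero    = refl
clamp-fromℕ (suc n) = cong suc (clamp-fromℕ n)

-- Climbing towards roots

module _ (G : Digraph) where

  Vertex Arc : Set
  Vertex = Fin (nV G)
  Arc    = Fin (nA G)

  private
    hd tl : Arc → Vertex
    hd = head G
    tl = tail G

  private variable
    X Y F F′ : ArcSet G
    e : Arc
    r t x y z : Vertex

  open IsDirectedForest

  record Up (X : ArcSet G) (y x : Vertex) : Set where
    constructor up
    field
      arc   : Arc
      arc∈  : arc ∈ X
      head≡ : hd arc ≡ y
      tail≡ : tl arc ≡ x

  Climb : ArcSet G → Vertex → Vertex → Set
  Climb X = Star (Up X)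

  IsRoot : ArcSet G → Vertex → Set
  IsRoot X r = ∀ {x} → ¬ Up X r x

  Rooted : ArcSet G → Vertex → Set
  Rooted X x = ∃ λ r → IsRoot X r × Climb X x r

  HeadInjective : ArcSet G → Set
  HeadInjective = InjectiveOn hd

  Up-mono : X ⊆ Y → Up X y x → Up Y y x
  Up-mono X⊆Y (up a a∈X ha ta) = up a (X⊆Y a∈X) ha ta

  Climb-mono : X ⊆ Y → Climb X y x → Climb Y y x
  Climb-mono X⊆Y = gmap id (Up-mono X⊆Y)

  IsRoot-antimono : Y ⊆ X → IsRoot X r → IsRoot Y r
  IsRoot-antimono Y⊆X isr = isr ∘ Up-mono Y⊆X

  Up-functional : HeadInjective X → Up X y x → Up X y z → x ≡ z
  Up-functional inj (up a a∈ ha ta) (up b b∈ hb tb) =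
    trans (sym ta) (trans (cong tl (inj a b a∈ b∈ (trans ha (sym hb)))) tb)

  parent? : (X : ArcSet G) (y : Vertex) → Dec (∃ (Up X y))
  parent? X y = map′ (λ (a , a∈ , ha) → tl a , up a a∈ ha refl) (λ (_ , up a a∈ ha _) → a , a∈ , ha)
                     (any? λ a → a ∈? X ×-dec hd a ≟ y)

  root-climb : IsRoot X r → Climb X r x → r ≡ x
  root-climb isr ε       = refl
  root-climb isr (u ◅ _) = ⊥-elim (isr u)

  ancestor-on-root-climb : HeadInjective X → Y ⊆ X → IsRoot X r → Climb Y t r → Climb X t z → Climb Y z r
  ancestor-on-root-climb inj Y⊆X isr p       ε       = p
  ancestor-on-root-climb inj Y⊆X isr ε       (u ◅ _) = ⊥-elim (isr u)
  ancestor-on-root-climb inj Y⊆X isr (v ◅ p) (u ◅ q) with Up-functional inj (Up-mono Y⊆X v) u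
  ... | refl = ancestor-on-root-climb inj Y⊆X isr p q

  entering-arc-on-root-climb : HeadInjective X → Y ⊆ X → IsRoot X r → e ∈ X → Climb Y (hd e) r → e ∈ Y
  entering-arc-on-root-climb inj Y⊆X isr e∈X ε = ⊥-elim (isr (up _ e∈X refl refl))
  entering-arc-on-root-climb {e = e} inj Y⊆X isr e∈X (up a a∈Y ha _ ◅ _) =
    subst (_∈ _) (inj a e (Y⊆X a∈Y) e∈X ha) a∈Y

  no-directed-cycle : HeadInjective X → IsRoot X r → Climb X y r → Up X y z → ¬ Climb X z y
  no-directed-cycle inj isr ε       u _ = isr u
  no-directed-cycle inj isr (v ◅ p) u c with Up-functional inj v u
  ... | refl with c
  ...   | ε      = no-directed-cycle inj isr p u ε
  ...   | w ◅ c′ = no-directed-cycle inj isr p w (c′ ◅◅ (u ◅ ε))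

  -- Forests are the head-injective arc sets in which every vertex climbs to a root

  -- UCycle reindexed by ℕ, so that the successor of an index needs no cast.
  record Cycle (X : ArcSet G) : Set where
    field
      len           : ℕ
      vertex        : ℕ → Vertex
      arc           : ℕ → Arc
      arc∈          : ∀ {k} → k ≤ len → arc k ∈ X
      joins         : ∀ {k} → k ≤ len → Joins G (arc k) (vertex k) (vertex (suc k))
      closed        : vertex 0 ≡ vertex (suc len)
      arc-injective : ∀ {k k′} → k ≤ len → k′ ≤ len → arc k ≡ arc k′ → k ≡ k′

  fromCycle : Cycle X → UCycle G X
  fromCycle C = record
    { len     = len
    ; arc     = arc ∘ toℕ
    ; vtx     = vertex ∘ toℕ
    ; arc-inj = λ i j → toℕ-injective ∘ arc-injective (toℕ≤pred[n] i) (toℕ≤pred[n] j)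
    ; arc-in  = λ i → arc∈ (toℕ≤pred[n] i)
    ; joins   = λ i → subst (λ k → Joins G (arc (toℕ i)) (vertex k) (vertex (suc (toℕ i))))
                            (sym (toℕ-inject₁ i)) (joins (toℕ≤pred[n] i))
    ; closed  = trans closed (cong vertex (sym (toℕ-fromℕ (suc len))))
    }
    where open Cycle C

  toCycle : UCycle G X → Cycle X
  toCycle C = record
    { len           = len
    ; vertex        = vtx ∘ clamp (suc len)
    ; arc           = arc ∘ clamp len
    ; arc∈          = λ _ → arc-in _
    ; joins         = λ {k} k≤len → subst (λ i → Joins G (arc (clamp len k)) (vtx i) (vtx (suc (clamp len k))))
                                          (inject₁-clamp k≤len) (joins (clamp len k))
    ; closed        = trans closed (cong vtx (sym (clamp-fromℕ (suc len))))
    ; arc-injective = λ k≤len k′≤len eq →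
        trans (sym (toℕ-clamp k≤len)) (trans (cong toℕ (arc-inj _ _ eq)) (toℕ-clamp k′≤len))
    }
    where open UCycle C

  module _ (inj : HeadInjective X) (C : Cycle X) where
    open Cycle C

    Forward Backward : ℕ → Set
    Forward  k = tl (arc k) ≡ vertex k       × hd (arc k) ≡ vertex (suc k)
    Backward k = tl (arc k) ≡ vertex (suc k) × hd (arc k) ≡ vertex k

    private
      same-head : ∀ {k k′} → k ≤ len → k′ ≤ len → hd (arc k) ≡ hd (arc k′) → k ≡ k′
      same-head k≤len k′≤len = arc-injective k≤len k′≤len ∘ inj _ _ (arc∈ k≤len) (arc∈ k′≤len)

      forward-step : ∀ {k} → suc k ≤ len → Forward k → Forward (suc k)
      forward-step k<len (_ , hk) with joins k<len
      ... | inj₁ fk+1       = fk+1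
      ... | inj₂ (_ , hk+1) = ⊥-elim (1+n≢n (sym (same-head (<⇒≤ k<len) k<len (trans hk (sym hk+1)))))

      forward-upto : ∀ {k m} → k ≤′ m → m ≤ len → Forward k → Forward m
      forward-upto ≤′-refl        _     fk = fk
      forward-upto (≤′-step k≤′m) m<len fk = forward-step m<len (forward-upto k≤′m (<⇒≤ m<len) fk)

    -- If arc 0 points backwards and some arc k forwards, then arcs k, …, len all point forwards,
    -- and arcs len and 0 both enter vertex 0: the cycle is a single loop.
    consistently-oriented : (∀ {k} → k ≤ len → Forward k) ⊎ (∀ {k} → k ≤ len → Backward k)
    consistently-oriented with joins z≤n
    ... | inj₁ f0 = inj₁ λ k≤len → forward-upto (≤⇒≤′ z≤n) k≤len f0
    ... | inj₂ b0 = inj₂ backward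
      where
      backward : ∀ {k} → k ≤ len → Backward k
      backward k≤len with joins k≤len
      ... | inj₂ bk = bk
      ... | inj₁ fk = subst Backward (sym (n≤0⇒n≡0 (subst (_ ≤_) len≡0 k≤len))) b0
        where
        len≡0 : len ≡ 0
        len≡0 = same-head ≤-refl z≤n
          (trans (proj₂ (forward-upto (≤⇒≤′ k≤len) ≤-refl fk)) (trans (sym closed) (sym (proj₂ b0))))

    directed-cycle : ∃₂ λ y z → Up X y z × Climb X z y
    directed-cycle with consistently-oriented
    ... | inj₁ forward =
      vertex 1 , vertex 0 , up (arc 0) (arc∈ z≤n) (proj₂ (forward z≤n)) (proj₁ (forward z≤n)) ,
      subst (λ v → Climb X v (vertex 1)) (sym closed)
        (reverse id (star-along {R = flip (Up X)} (vertex ∘ suc) len λ {k} k<len →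
          up (arc (suc k)) (arc∈ k<len) (proj₂ (forward k<len)) (proj₁ (forward k<len))))
    ... | inj₂ backward =
      vertex 0 , vertex 1 , up (arc 0) (arc∈ z≤n) (proj₂ (backward z≤n)) (proj₁ (backward z≤n)) ,
      subst (Climb X (vertex 1)) (sym closed)
        (star-along (vertex ∘ suc) len λ {k} k<len →
          up (arc (suc k)) (arc∈ k<len) (proj₂ (backward k<len)) (proj₁ (backward k<len)))

  rooted⇒forest : HeadInjective X → (∀ x → Rooted X x) → IsDirectedForest G X
  rooted⇒forest inj rooted = record { acyclic = no-ucycle ; indeg≤1 = inj }
    where
    no-ucycle : UCycle G _ → ⊥₀
    no-ucycle C with directed-cycle inj (toCycle C)
    ... | y , _ , u , c with rooted y
    ...   | _ , isr , p = no-directed-cycle inj isr p u c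

  record SimpleClimb (X : ArcSet G) (x : Vertex) (n : ℕ) : Set where
    field
      vertex           : ℕ → Vertex
      arc              : ℕ → Arc
      starts           : vertex 0 ≡ x
      steps            : ∀ {k} → k < n → arc k ∈ X × hd (arc k) ≡ vertex k × tl (arc k) ≡ vertex (suc k)
      vertex-injective : InjectiveBelow vertex (suc n)

  module _ {a n} (a∈X : a ∈ X) (P : SimpleClimb X (tl a) n) where
    open SimpleClimb P

    private
      steps′ : ∀ {k} → k < suc n →
               cons a arc k ∈ X × hd (cons a arc k) ≡ cons (hd a) vertex k × tl (cons a arc k) ≡ cons (hd a) vertex (suc k)
      steps′ {zero}  _         = a∈X , refl , sym starts
      steps′ {suc k} (s≤s k<n) = steps k<n

    prepend : (∀ {k} → k < suc n → vertex k ≢ hd a) → SimpleClimb X (hd a) (suc n)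
    prepend fresh = record
      { vertex           = cons (hd a) vertex
      ; arc              = cons a arc
      ; starts           = refl
      ; steps            = steps′
      ; vertex-injective = cons-injective vertex-injective fresh
      }

    close-cycle : ∀ {k} → k < suc n → vertex k ≡ hd a → Cycle X
    close-cycle {k} k<1+n vk≡ha = record
      { len           = k
      ; vertex        = cons (hd a) vertex
      ; arc           = cons a arc
      ; arc∈          = λ j≤k → proj₁ (steps′ (upto j≤k))
      ; joins         = λ j≤k → let _ , hj , tj = steps′ (upto j≤k) in inj₂ (tj , hj)
      ; closed        = sym vk≡ha
      ; arc-injective = λ j≤k j′≤k aj≡aj′ → cycle-injective (s≤s j≤k) (s≤s j′≤k)
          (trans (sym (head-at j≤k)) (trans (cong hd aj≡aj′) (head-at j′≤k)))
      }
      where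
      upto : ∀ {j} → j ≤ k → j < suc n
      upto j≤k = ≤-trans (s≤s j≤k) k<1+n
      head-at : ∀ {j} → j ≤ k → hd (cons a arc j) ≡ cons (hd a) vertex j
      head-at j≤k = proj₁ (proj₂ (steps′ (upto j≤k)))
      below : ∀ {j} → j < k → j < suc n
      below j<k = ≤-trans j<k (<⇒≤ k<1+n)
      cycle-injective : InjectiveBelow (cons (hd a) vertex) (suc k)
      cycle-injective = cons-injective
        (λ i<k j<k → vertex-injective (below i<k) (below j<k))
        (λ j<k vj≡ha → <⇒≢ j<k (vertex-injective (below j<k) k<1+n (trans vj≡ha (sym vk≡ha))))

  private
    root-rooted : ¬ ∃ (Up X x) → Rooted X x
    root-rooted no-parent = _ , (λ u → no-parent (_ , u)) , ε

  rooted-or-simple : IsDirectedForest G X → ∀ n x → Rooted X x ⊎ SimpleClimb X x n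
  rooted-or-simple {X} fX zero x with parent? X x
  ... | no no-parent = inj₁ (root-rooted no-parent)
  ... | yes (_ , up a _ refl _) = inj₂ (record
    { vertex = λ _ → hd a ; arc = λ _ → a ; starts = refl ; steps = λ ()
    ; vertex-injective = λ { (s≤s z≤n) (s≤s z≤n) _ → refl } })
  rooted-or-simple {X} fX (suc n) x with parent? X x
  ... | no no-parent = inj₁ (root-rooted no-parent)
  ... | yes (_ , up a a∈X refl refl) with rooted-or-simple fX n (tl a)
  ...   | inj₁ (r , isr , p) = inj₁ (r , isr , up a a∈X refl refl ◅ p)
  ...   | inj₂ P with anyUpTo? (λ k → SimpleClimb.vertex P k ≟ hd a) (suc n)
  ...     | yes (k , k<1+n , vk≡ha) = ⊥-elim (acyclic fX (fromCycle (close-cycle a∈X P k<1+n vk≡ha)))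
  ...     | no fresh                = inj₂ (prepend a∈X P λ k<1+n vk≡ha → fresh (_ , k<1+n , vk≡ha))

  -- A simple climb of nV arcs would visit nV + 1 distinct vertices.
  forest⇒rooted : IsDirectedForest G X → ∀ x → Rooted X x
  forest⇒rooted fX x with rooted-or-simple fX (nV G) x
  ... | inj₁ rooted = rooted
  ... | inj₂ P with pigeonhole (n<1+n (nV G)) (SimpleClimb.vertex P ∘ toℕ)
  ...   | i , j , i<j , eq = ⊥-elim (<⇒≢ i<j (SimpleClimb.vertex-injective P (toℕ<n i) (toℕ<n j) eq))

  UCycle-mono : Y ⊆ X → UCycle G Y → UCycle G X
  UCycle-mono Y⊆X C = record
    { len = len ; arc = arc ; vtx = vtx ; arc-inj = arc-inj ; arc-in = Y⊆X ∘ arc-in ; joins = joins ; closed = closed }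
    where open UCycle C

  forest-⊆ : Y ⊆ X → IsDirectedForest G X → IsDirectedForest G Y
  forest-⊆ Y⊆X fX = record
    { acyclic = acyclic fX ∘ UCycle-mono Y⊆X
    ; indeg≤1 = λ a b a∈Y b∈Y → indeg≤1 fX a b (Y⊆X a∈Y) (Y⊆X b∈Y)
    }

  add-arc-forest : IsDirectedForest G Y → IsRoot Y (hd e) → ¬ Climb Y (tl e) (hd e) → IsDirectedForest G (Y ∪ ⁅ e ⁆)
  add-arc-forest {Y} {e} fY he-root ¬climb = rooted⇒forest injective rooted
    where
    Y⊆ : Y ⊆ Y ∪ ⁅ e ⁆
    Y⊆ = p⊆p∪q ⁅ e ⁆
    e∈ : e ∈ Y ∪ ⁅ e ⁆
    e∈ = x∈p∪q⁺ (inj₂ (x∈⁅x⁆ e))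

    injective : HeadInjective (Y ∪ ⁅ e ⁆)
    injective a b a∈ b∈ ha≡hb with x∈p∪⁅y⁆⁻ a∈ | x∈p∪⁅y⁆⁻ b∈
    ... | inj₁ a∈Y | inj₁ b∈Y = indeg≤1 fY a b a∈Y b∈Y ha≡hb
    ... | inj₁ a∈Y | inj₂ refl = ⊥-elim (he-root (up a a∈Y ha≡hb refl))
    ... | inj₂ refl | inj₁ b∈Y = ⊥-elim (he-root (up b b∈Y (sym ha≡hb) refl))
    ... | inj₂ refl | inj₂ refl = refl

    rooted-unless-below-head : ∀ x → Rooted (Y ∪ ⁅ e ⁆) x ⊎ Climb Y x (hd e)
    rooted-unless-below-head x with forest⇒rooted fY x
    ... | r , r-root , p with hd e ≟ r
    ...   | yes refl = inj₂ p
    ...   | no he≢r  = inj₁ (r , r-root′ , Climb-mono Y⊆ p)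
      where
      r-root′ : IsRoot (Y ∪ ⁅ e ⁆) r
      r-root′ (up a a∈ ha ta) with x∈p∪⁅y⁆⁻ a∈
      ... | inj₁ a∈Y = r-root (up a a∈Y ha ta)
      ... | inj₂ refl = he≢r ha

    rooted : ∀ x → Rooted (Y ∪ ⁅ e ⁆) x
    rooted x with rooted-unless-below-head x | rooted-unless-below-head (tl e)
    ... | inj₁ rooted-x     | _                     = rooted-x
    ... | inj₂ _            | inj₂ te-below         = ⊥-elim (¬climb te-below)
    ... | inj₂ x-below-head | inj₁ (r , r-root , p) = r , r-root , Climb-mono Y⊆ x-below-head ◅◅ (up e e∈ refl refl ◅ p)

  Heads : ArcSet G → Subset (nV G)
  Heads = image hd

  Up⇒∈Heads : Up X y x → y ∈ Heads X
  Up⇒∈Heads (up a a∈X refl _) = ∈image⁺ a∈X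

  ∈Heads⇒Up : y ∈ Heads X → ∃ (Up X y)
  ∈Heads⇒Up y∈ with ∈image⁻ y∈
  ... | a , a∈X , ha = tl a , up a a∈X ha refl

  roots-shared : HeadInjective X → HeadInjective Y → ∣ X ∣ ≡ ∣ Y ∣ → Heads Y ⊆ Heads X → IsRoot Y r → IsRoot X r
  roots-shared injX injY ∣X∣≡∣Y∣ HY⊆HX r-root u = r-root (proj₂ (∈Heads⇒Up (HX⊆HY (Up⇒∈Heads u))))
    where
    HX⊆HY = ⊆∧∣≡∣⇒⊇ HY⊆HX (trans (∣image∣≡∣p∣ injY) (trans (sym ∣X∣≡∣Y∣) (sym (∣image∣≡∣p∣ injX))))

  record LastArcOutside (X Y : ArcSet G) (t r : Vertex) : Set where
    field
      arc   : Arc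
      arc∈X : arc ∈ X
      arc∉Y : arc ∉ Y
      below : Climb X t (hd arc)
      above : Climb (X ∩ Y) (tl arc) r

  last-arc-outside : ∀ Y → Climb X t r → Climb (X ∩ Y) t r ⊎ LastArcOutside X Y t r
  last-arc-outside Y ε = inj₁ ε
  last-arc-outside Y (up a a∈X refl refl ◅ p) with last-arc-outside Y p
  ... | inj₂ last = inj₂ (record
    { arc = arc ; arc∈X = arc∈X ; arc∉Y = arc∉Y ; below = up a a∈X refl refl ◅ below ; above = above })
    where open LastArcOutside last
  ... | inj₁ p∩ with a ∈? Y
  ...   | yes a∈Y = inj₁ (up a (x∈p∩q⁺ (a∈X , a∈Y)) refl refl ◅ p∩)
  ...   | no a∉Y  = inj₂ (record { arc = a ; arc∈X = a∈X ; arc∉Y = a∉Y ; below = ε ; above = p∩ })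

  last-arc-outside-from : e ∈ X → e ∉ Y → Climb X (tl e) r → ∃ λ e′ → e′ ∈ X × e′ ∉ Y × Climb (X ∩ Y) (tl e′) r
  last-arc-outside-from {Y = Y} e∈X e∉Y p with last-arc-outside Y p
  ... | inj₁ p∩   = _ , e∈X , e∉Y , p∩
  ... | inj₂ last = arc , arc∈X , arc∉Y , above
    where open LastArcOutside last

  -- Exchange

  Exchange : ArcSet G → ArcSet G → Set
  Exchange F F′ = ∃₂ λ e e′ → e ∈ F × e ∉ F′ × e′ ∈ F′ × e′ ∉ F × IsDirectedForest G ((F - e) ∪ ⁅ e′ ⁆)

  exchange : ∀ {e e′} → IsDirectedForest G F → e ∈ F → e ∉ F′ → e′ ∈ F′ → e′ ∉ F →
             IsRoot (F - e) (hd e′) → ¬ Climb (F - e) (tl e′) (hd e′) → Exchange F F′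
  exchange {F = F} fF e∈F e∉F′ e′∈F′ e′∉F he′-root ¬climb =
    _ , _ , e∈F , e∉F′ , e′∈F′ , e′∉F , add-arc-forest (forest-⊆ (p─q⊆p F _) fF) he′-root ¬climb

  separating-arc : ∀ {e₀ e′} → IsDirectedForest G F → IsDirectedForest G F′ → e₀ ∈ F → e₀ ∉ F′ →
                   e′ ∈ F′ → IsRoot F (hd e′) → ∃ λ e → e ∈ F × e ∉ F′ × ¬ Climb (F - e) (tl e′) (hd e′)
  separating-arc {F} {F′} {e′ = e′} fF fF′ e₀∈F e₀∉F′ e′∈F′ he′-root with forest⇒rooted fF (tl e′)
  ... | ρ , ρ-root , p with last-arc-outside F′ p
  ...   | inj₂ last = arc , arc∈X , arc∉Y , λ c →
    -- the climb from tl e′ to the root hd e′ is unique and passes through the removed arc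
    x∉p-x (entering-arc-on-root-climb (indeg≤1 fF) (p─q⊆p F _) he′-root arc∈X
             (ancestor-on-root-climb (indeg≤1 fF) (p─q⊆p F _) he′-root c below))
    where open LastArcOutside last
  ...   | inj₁ p∩ = _ , e₀∈F , e₀∉F′ , λ c →
    -- tl e′ climbs in F to both roots hd e′ and ρ, so they agree and F ∩ F′ closes a cycle with e′.
    let he′≡ρ = root-climb (IsRoot-antimono (p∩q⊆p F F′) he′-root)
                  (ancestor-on-root-climb (indeg≤1 fF) (p∩q⊆p F F′) ρ-root p∩ (Climb-mono (p─q⊆p F _) c))
        _ , r-root , q = forest⇒rooted fF′ (hd e′)
    in no-directed-cycle (indeg≤1 fF′) r-root q (up e′ e′∈F′ refl refl)
         (subst (Climb F′ (tl e′)) (sym he′≡ρ) (Climb-mono (p∩q⊆q F F′) p∩))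

  exchange-into-root : ∀ {e₀ e′} → IsDirectedForest G F → IsDirectedForest G F′ → e₀ ∈ F → e₀ ∉ F′ →
                       e′ ∈ F′ → IsRoot F (hd e′) → Exchange F F′
  exchange-into-root {F} {e′ = e′} fF fF′ e₀∈F e₀∉F′ e′∈F′ he′-root
    with separating-arc fF fF′ e₀∈F e₀∉F′ e′∈F′ he′-root
  ... | _ , e∈F , e∉F′ , ¬climb = exchange fF e∈F e∉F′ e′∈F′ (λ e′∈F → he′-root (up e′ e′∈F refl refl))
                                    (IsRoot-antimono (p─q⊆p F _) he′-root) ¬climb

  exchange-below-shared-roots : ∀ {e₀′} → IsDirectedForest G F → IsDirectedForest G F′ → ∣ F ∣ ≡ ∣ F′ ∣ →
                                Heads F′ ⊆ Heads F → e₀′ ∈ F′ → e₀′ ∉ F → Exchange F F′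
  exchange-below-shared-roots {F} {F′} {e₀′} fF fF′ ∣F∣≡∣F′∣ HF′⊆HF e₀′∈F′ e₀′∉F
    with forest⇒rooted fF′ (tl e₀′)
  ... | ρ , ρ-root′ , p with last-arc-outside-from e₀′∈F′ e₀′∉F p
  ...   | e′ , e′∈F′ , e′∉F , p∩ with ∈Heads⇒Up (HF′⊆HF (Up⇒∈Heads (up e′ e′∈F′ refl refl)))
  ...     | _ , up f f∈F hf≡he′ _ = exchange fF f∈F f∉F′ e′∈F′ e′∉F he′-root ¬climb
    where
    f∉F′ : f ∉ F′
    f∉F′ f∈F′ = e′∉F (subst (_∈ F) (indeg≤1 fF′ f e′ f∈F′ e′∈F′ hf≡he′) f∈F)
    he′-root : IsRoot (F - f) (hd e′)
    he′-root (up b b∈ hb≡he′ _) =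
      x∉p-x (subst (_∈ F - f) (indeg≤1 fF b f (p─q⊆p F _ b∈) f∈F (trans hb≡he′ (sym hf≡he′))) b∈)
    ρ-root : IsRoot F ρ
    ρ-root = roots-shared (indeg≤1 fF) (indeg≤1 fF′) ∣F∣≡∣F′∣ HF′⊆HF ρ-root′
    -- tl e′ climbs in F ∩ F′ to the common root ρ, so a climb to hd e′ in F would enter
    -- hd e′ through an arc of F′ ∩ F, which can only be e′ ∉ F.
    ¬climb : ¬ Climb (F - f) (tl e′) (hd e′)
    ¬climb c = e′∉F (proj₂ (x∈p∩q⁻ F′ F
      (entering-arc-on-root-climb (indeg≤1 fF′) (p∩q⊆p F′ F) ρ-root′ e′∈F′
        (ancestor-on-root-climb (indeg≤1 fF) (p∩q⊆q F′ F) ρ-root p∩ (Climb-mono (p─q⊆p F _) c)))))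

  forest-exchange : IsDirectedForest G F → IsDirectedForest G F′ → ∣ F ∣ ≡ ∣ F′ ∣ → F ≢ F′ → Exchange F F′
  forest-exchange {F} {F′} fF fF′ ∣F∣≡∣F′∣ F≢F′
    with ∣p∣≡∣q∣∧p≢q⇒∃x∈p∉q ∣F∣≡∣F′∣ F≢F′ | ∣p∣≡∣q∣∧p≢q⇒∃x∈p∉q (sym ∣F∣≡∣F′∣) (F≢F′ ∘ sym)
       | ⊆-or-witness (Heads F′) (Heads F)
  ... | _ , e₀∈F , e₀∉F′ | _ | inj₂ (_ , y∈HF′ , y∉HF) with ∈Heads⇒Up y∈HF′
  ...   | _ , up e′ e′∈F′ refl _ = exchange-into-root fF fF′ e₀∈F e₀∉F′ e′∈F′ (y∉HF ∘ Up⇒∈Heads)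
  forest-exchange fF fF′ ∣F∣≡∣F′∣ F≢F′ | _ | _ , e₀′∈F′ , e₀′∉F | inj₁ HF′⊆HF =
    exchange-below-shared-roots fF fF′ ∣F∣≡∣F′∣ HF′⊆HF e₀′∈F′ e₀′∉F

theorem4 : (G : Digraph) (k : ℕ) (F F′ : ArcSet G) → IsDirectedForest G F → IsDirectedForest G F′ → ∣ F ∣ ≡ k → ∣ F′ ∣ ≡ k → F ≢ F′
    → ∃₂ λ e e′ → e ∈ F × e ∉ F′ × e′ ∈ F′ × e′ ∉ F × IsDirectedForest G ((F - e) ∪ ⁅ e′ ⁆)
theorem4 G k F F′ fF fF′ ∣F∣≡k ∣F′∣≡k = forest-exchange G fF fF′ (trans ∣F∣≡k (sym ∣F′∣≡k))
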